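{- Let $n,k$ be powers of $2$ with $2\le k\le n/2$. Let $\bar l=\langle l_1,\dots,l_{n/2}\rangle\in\mathbb N^{n/2}$ be top $k$ sorted, let $\bar r=\langle r_1,\dots,r_{n/2}\rangle\in\mathbb N^{n/2}$ be top $k/2$ sorted, and assume $l_i\ge r_i$ for all $1\le i\le k/2$. Apply the comparator network $pw\_hbit\_merge^n_k$ to $\bar l::\bar r$: (1) compute $\bar y=bit\_split^k(l_{k/2+1},\dots,l_k,r_1,\dots,r_{k/2})$ and let $\bar b=\langle l_1,\dots,l_{k/2}\rangle::\langle y_1,\dots,y_{k/2}\rangle$ (a sequence of length $k$); (2) compute $half\_bit\_merge^k(\bar b)$. Then the output of step (2) is sorted and coincides with the first $k$ entries of the nonincreasing rearrangement of $\bar l::\bar r$ (i.e. it consists of the $k$ largest elements of $\bar l::\bar r$, in sorted order). Moreover, the network $pw\_hbit\_merge^n_k$ consists of exactly $\frac{k\log_2 k}{2}$ comparators.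
   Context: A sequence $\bar x=\langle x_1,\dots,x_m\rangle\in\mathbb N^m$ is sorted if $x_1\ge x_2\ge\dots\ge x_m$. For sequences $\bar x,\bar y$, $\bar x::\bar y$ denotes concatenation; $left(\bar x)$ and $right(\bar x)$ denote the first and second halves of a sequence of even length. For $\bar x\in\mathbb N^p$, $\bar y\in\mathbb N^q$, write $\bar x\succeq\bar y$ if $x_i\ge y_j$ for all $i,j$. A sequence $\bar x\in\mathbb N^m$ is top $k$ sorted ($k\le m$) if $\langle x_1,\dots,x_k\rangle$ is sorted and $\langle x_1,\dots,x_k\rangle\succeq\langle x_{k+1},\dots,x_m\rangle$. A comparator $c_{i,j}$ ($i<j$) acting on a sequence replaces the entry at position $i$ by the maximum and the entry at position $j$ by the minimum of the two entries, leaving the others unchanged; a comparator network is a composition of finitely many comparators, and its size is the number of comparators. For $m$ even: $split^m$ applies the comparators $c_{i,m/2+i}$ for $i=1,\dots,m/2$; $bit\_split^m$ applies $c_{i,m-i+1}$ for $i=1,\dots,m/2$ (these comparators act on disjoint pairs). For $m$ a power of 2, Batcher's bitonic merger $bit\_merge^m$ is: for $m=1$ no comparators; for $m=2$ the single comparator $c_{1,2}$; for $m>2$ apply $split^m$, then recursively $bit\_merge^{m/2}$ to the left half and to the right half. For $m\ge4$ a power of 2, $half\_split^m$ applies the comparators $c_{i,m/2+i}$ for $i=m/4+1,\dots,m/2$ only (i.e. $split^m$ with its first $m/4$ comparators removed). For $m$ a power of $2$, $m\ge2$, $half\_bit\_merge^m(\bar b)$ is: if $m=2$, return $\bar b$ unchanged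 (no comparators); otherwise let $\bar b'=half\_split^m(\bar b)$ and return $half\_bit\_merge^{m/2}(left(\bar b'))::bit\_merge^{m/2}(right(\bar b'))$. -}

module Defs where

open import Data.Nat using (ℕ; zero; suc; _+_; _*_; _≤_; _<_; _≥_; _⊔_; _⊓_)
open import Data.Nat.Properties using (<-trans; <-≤-trans; ≤-trans; m≤m+n; m≤n+m; +-monoʳ-<; +-monoʳ-≤; +-mono-≤)
open import Data.Fin using (Fin; toℕ; fromℕ<; opposite)
open import Data.Fin.Properties using (toℕ<n)
open import Data.Vec using (Vec; lookup; _[_]≔_)
open import Data.List using (List; []; _∷_; _++_; map; allFin; take; drop)
open import Data.List.Relation.Unary.All using (All)
open import Data.List.Relation.Unary.Linked using (Linked)

Sorted : List ℕ → Set
Sorted = Linked _≥_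

_⪰_ : List ℕ → List ℕ → Set
xs ⪰ ys = All (λ x → All (λ y → x ≥ y) ys) xs

TopSorted : ℕ → List ℕ → Set
TopSorted k xs = Sorted (take k xs) × (take k xs ⪰ drop k xs)
  where open import Data.Product using (_×_)

pow2 : ℕ → ℕ
pow2 zero    = 1
pow2 (suc a) = pow2 a + pow2 a

-- Comparators and comparator networks on m wires.
-- Positions are 0-based natural numbers: paper position p is index p-1.

record Comparator (m : ℕ) : Set where
  constructor cmp
  field
    i j : ℕ
    i<j : i < j
    j<m : j < m

applyC : {m : ℕ} → Comparator m → Vec ℕ m → Vec ℕ m
applyC (cmp i j i<j j<m) v =
  let fi = fromℕ< (<-trans i<j j<m)
      fj = fromℕ< j<m
      x  = lookup v fi
      y  = lookup v fj
  in (v [ fi ]≔ (x ⊔ y)) [ fj ]≔ (x ⊓ y)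

Network : ℕ → Set
Network m = List (Comparator m)

run : {m : ℕ} → Network m → Vec ℕ m → Vec ℕ m
run []       v = v
run (c ∷ cs) v = run cs (applyC c v)

-- size = number of comparators = Data.List.length

widenC : {m m' : ℕ} → m ≤ m' → Comparator m → Comparator m'
widenC m≤m' (cmp i j i<j j<m) = cmp i j i<j (<-≤-trans j<m m≤m')

shiftC : {m : ℕ} (d : ℕ) → Comparator m → Comparator (d + m)
shiftC d (cmp i j i<j j<m) = cmp (d + i) (d + j) (+-monoʳ-< d i<j) (+-monoʳ-< d j<m)

_∥_ : {m m' : ℕ} → Network m → Network m' → Network (m + m')
_∥_ {m} {m'} N N' = map (widenC (m≤m+n m m')) N ++ map (shiftC m) N'

split : (h : ℕ) → Network (h + h)
split h = map (λ t → cmp (toℕ t) (h + toℕ t)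
                          (<-≤-trans (toℕ<n t) (m≤m+n h (toℕ t)))
                          (+-monoʳ-< h (toℕ<n t)))
              (allFin h)

-- bit_split^{2h}: c_{i, 2h-1-i} (0-based i < h); opposite t = h-1-t
bitSplit : (h : ℕ) → Network (h + h)
bitSplit h = map (λ t → cmp (toℕ t) (h + toℕ (opposite t))
                             (<-≤-trans (toℕ<n t) (m≤m+n h (toℕ (opposite t))))
                             (+-monoʳ-< h (toℕ<n (opposite t))))
                 (allFin h)

bitMerge : (a : ℕ) → Network (pow2 a)
bitMerge zero    = []
bitMerge (suc a) = split (pow2 a) ++ (bitMerge a ∥ bitMerge a)

halfSplit : (q : ℕ) → Network ((q + q) + (q + q))
halfSplit q =
  map (λ t → cmp (q + toℕ t) ((q + q) + (q + toℕ t))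
                 (<-≤-trans (+-monoʳ-< q (toℕ<n t)) (m≤m+n (q + q) (q + toℕ t)))
                 (+-monoʳ-< (q + q) (+-monoʳ-< q (toℕ<n t))))
      (allFin q)

halfBitMerge : (c : ℕ) → Network (pow2 (suc c))
halfBitMerge zero    = []
halfBitMerge (suc c) = halfSplit (pow2 c) ++ (halfBitMerge c ∥ bitMerge (suc c))

-- pw_hbit_merge^n_k with n = pow2 (suc d) = h + h (h = n/2 = pow2 d),
-- k = pow2 (suc c) = kh + kh (kh = k/2 = pow2 c), under k ≤ n/2.
--
-- Step (1): bit_split^k on the wires l_{k/2+1..k}, r_{1..k/2}; 0-based,
--   for t < kh the comparator joins wire kh + t (l_{k/2+1+t}) with
--   wire h + (kh - 1 - t) (r_{k/2-t}); the max side is wire kh + t,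
--   so b̄ occupies wires 0 .. k-1.
-- Step (2): half_bit_merge^k on wires 0 .. k-1.

pwStep1 : (d c : ℕ) → pow2 (suc c) ≤ pow2 d → Network (pow2 d + pow2 d)
pwStep1 d c k≤h =
  map (λ t → cmp (pow2 c + toℕ t) (pow2 d + toℕ (opposite t))
                 (<-≤-trans (+-monoʳ-< (pow2 c) (toℕ<n t))
                            (≤-trans k≤h (m≤m+n (pow2 d) (toℕ (opposite t)))))
                 (+-monoʳ-< (pow2 d)
                    (<-≤-trans (toℕ<n (opposite t))
                               (≤-trans (m≤m+n (pow2 c) (pow2 c)) k≤h))))
      (allFin (pow2 c))

pwHbitMerge : (d c : ℕ) → pow2 (suc c) ≤ pow2 d → Network (pow2 d + pow2 d)
pwHbitMerge d c k≤h =
  pwStep1 d c k≤h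
  ++ map (widenC (≤-trans k≤h (m≤m+n (pow2 d) (pow2 d)))) (halfBitMerge c)

-- Thresholding at x (wire p carries x ≤ v_p) turns every comparator into
-- (∨, ∧) on its two wires, so it suffices to study 0-1 inputs, one threshold at a time.
-- Thresholded, l̄ starts with α ones among its first k entries and r̄ with γ ones among
-- its first k/2, where γ ≤ α. Step (1) turns the first k wires into the valley
-- 1^α 0^(k−α−γ) 1^γ (all ones when α + γ ≥ k), whose last block of ones is no longer
-- than its first. On such valleys the comparators that half_split drops are idle, so
-- half_bit_merge sorts them just as Batcher's merger sorts bitonic sequences, and a
-- one left beyond wire k forces α + γ ≥ k. Hence the output is top-k ordered; as
-- networks only permute their input, its first k entries agree with those of every
-- sorted rearrangement.

module Submission where

open import Defs

open import Data.Bool using (Bool; true; false; _∨_; _∧_; not)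
open import Data.Bool.Properties
  using (∨-comm; ∧-comm; ∨-idem; ∧-idem; ∨-zeroʳ; ∨-identityʳ; ∧-zeroʳ; ∧-identityʳ;
         not-involutive; not-injective; ∨-∧-booleanAlgebra; T-≡)
open import Algebra.Lattice.Properties.BooleanAlgebra ∨-∧-booleanAlgebra using (deMorgan₁; deMorgan₂)
open import Data.Empty using (⊥-elim)
open import Data.Fin as F using (Fin; toℕ; fromℕ<; opposite)
open import Data.Fin.Properties as FinP
  using (toℕ-fromℕ<; toℕ<n; toℕ-injective; opposite-prop; opposite-involutive)
open import Data.List as L using (List; []; _∷_; take; length; allFin; tabulate)
open import Data.List.Properties
  using (take++drop≡id; map-tabulate; map-++; length-++; length-map; length-tabulate)
open import Data.List.Membership.Propositional using (_∈_)
open import Data.List.Relation.Unary.All using (All; []; _∷_)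
open import Data.List.Relation.Unary.All.Properties using (++⁺)
open import Data.List.Relation.Unary.Any using (here; there)
open import Data.List.Relation.Unary.Linked as Linked using ([]; [-]; _∷_)
open import Data.List.Relation.Unary.Linked.Properties using (Linked⇒All)
open import Data.List.Relation.Binary.Permutation.Propositional
  using (_↭_; ↭-refl; ↭-sym; ↭-trans; prep; swap)
open import Data.List.Relation.Binary.Permutation.Propositional.Properties
  using (∈-resp-↭; drop-∷; ↭-length)
open import Data.Nat hiding (_!)
open import Data.Nat.Properties
open import Data.Nat.DivMod using (m*n/n≡m)
open import Data.Nat.Solver using (module +-*-Solver)
open import Data.Product using (∃; ∃₂; _×_; _,_; proj₁; proj₂)
open import Data.Sum as Sum using (_⊎_; inj₁; inj₂)
open import Data.Vec as V using (Vec; lookup; toList; _[_]≔_; _++_)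
open import Data.Vec.Properties using ([]≔-lookup; toList-++; length-toList)
open import Function using (_∘_; id)
open import Function.Bundles using (module Equivalence)
open import Relation.Nullary using (yes; no)
open import Relation.Binary.PropositionalEquality

infixl 10 _!_

-- Positions past the end read as 0.
_!_ : List ℕ → ℕ → ℕ
[]       ! p     = 0
(x ∷ xs) ! zero  = x
(x ∷ xs) ! suc p = xs ! p

TopOrdered : ℕ → List ℕ → Set
TopOrdered k xs = ∀ p q → p < q → q < length xs → p < k → xs ! q ≤ xs ! p

All-! : ∀ {P : ℕ → Set} {xs} → All P xs → ∀ q → q < length xs → P (xs ! q)
All-! (px ∷ _)   zero    _        = px
All-! (_  ∷ pxs) (suc q) (s≤s q<) = All-! pxs q q<

∈⇒! : ∀ {z : ℕ} {xs} → z ∈ xs → ∃ λ q → q < length xs × xs ! q ≡ z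
∈⇒! (here refl) = 0 , z<s , refl
∈⇒! (there z∈)  with ∈⇒! z∈
... | q , q< , eq = suc q , s≤s q< , eq

TopOrdered-∷ : ∀ {k x xs} → All (_≤ x) xs → TopOrdered k xs → TopOrdered (suc k) (x ∷ xs)
TopOrdered-∷ x≥xs top zero    (suc q) _          (s≤s q<) _          = All-! x≥xs q q<
TopOrdered-∷ x≥xs top (suc p) (suc q) (s≤s p<q) (s≤s q<) (s≤s p<k) = top p q p<q q< p<k

TopOrdered-tail : ∀ {k x xs} → TopOrdered (suc k) (x ∷ xs) → TopOrdered k xs
TopOrdered-tail top p q p<q q< p<k = top (suc p) (suc q) (s≤s p<q) (s≤s q<) (s≤s p<k)

TopOrdered-head : ∀ {k x xs z} → TopOrdered (suc k) (x ∷ xs) → z ∈ x ∷ xs → z ≤ x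
TopOrdered-head top (here refl) = ≤-refl
TopOrdered-head top (there z∈) with ∈⇒! z∈
... | q , q< , refl = top 0 (suc q) z<s (s≤s q<) z<s

Sorted-head : ∀ {x xs} → Sorted (x ∷ xs) → All (_≤ x) xs
Sorted-head sorted with Linked⇒All (λ y≤x z≤y → ≤-trans z≤y y≤x) ≤-refl sorted
... | _ ∷ x≥xs = x≥xs

Sorted⇒TopOrdered : ∀ k {xs} → Sorted xs → TopOrdered k xs
Sorted⇒TopOrdered zero    _ _ _ _ _ ()
Sorted⇒TopOrdered (suc k) {[]}     _      _ _ _ ()
Sorted⇒TopOrdered (suc k) {x ∷ xs} sorted =
  TopOrdered-∷ (Sorted-head sorted) (Sorted⇒TopOrdered k (Linked.tail sorted))

TopSorted⇒TopOrdered : ∀ k {xs} → TopSorted k xs → TopOrdered k xs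
TopSorted⇒TopOrdered zero    _ _ _ _ _ ()
TopSorted⇒TopOrdered (suc k) {[]}     _ _ _ _ ()
TopSorted⇒TopOrdered (suc k) {x ∷ xs} (sorted , x≥rest ∷ top≥rest) =
  TopOrdered-∷ x≥xs (TopSorted⇒TopOrdered k (Linked.tail sorted , top≥rest))
  where
  x≥xs : All (_≤ x) xs
  x≥xs = subst (All (_≤ x)) (take++drop≡id k xs) (++⁺ (Sorted-head sorted) x≥rest)

TopOrdered⇒Sorted-take : ∀ k xs → TopOrdered k xs → Sorted (take k xs)
TopOrdered⇒Sorted-take zero          xs           _   = []
TopOrdered⇒Sorted-take (suc k)       []           _   = []
TopOrdered⇒Sorted-take (suc zero)    (x ∷ xs)     _   = [-]
TopOrdered⇒Sorted-take (suc (suc k)) (x ∷ [])     _   = [-]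
TopOrdered⇒Sorted-take (suc (suc k)) (x ∷ y ∷ xs) top =
  top 0 1 z<s (s≤s z<s) z<s ∷ TopOrdered⇒Sorted-take (suc k) (y ∷ xs) (TopOrdered-tail top)

↭-TopOrdered⇒take≡ : ∀ k {xs ys} → xs ↭ ys → TopOrdered k xs → TopOrdered k ys → take k xs ≡ take k ys
↭-TopOrdered⇒take≡ zero    _ _ _ = refl
↭-TopOrdered⇒take≡ (suc k) {[]}     {[]}     _ _ _ = refl
↭-TopOrdered⇒take≡ (suc k) {[]}     {_ ∷ _}  xs↭ys _ _ with () ← ↭-length xs↭ys
↭-TopOrdered⇒take≡ (suc k) {_ ∷ _}  {[]}     xs↭ys _ _ with () ← ↭-length xs↭ys
↭-TopOrdered⇒take≡ (suc k) {x ∷ xs} {y ∷ ys} xs↭ys topx topy =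
  cong₂ _∷_ x≡y (↭-TopOrdered⇒take≡ k tails↭ (TopOrdered-tail topx) (TopOrdered-tail topy))
  where
  x≡y : x ≡ y
  x≡y = ≤-antisym (TopOrdered-head topy (∈-resp-↭ xs↭ys (here refl)))
                  (TopOrdered-head topx (∈-resp-↭ (↭-sym xs↭ys) (here refl)))
  tails↭ : xs ↭ ys
  tails↭ = drop-∷ (subst (λ w → x ∷ xs ↭ w ∷ ys) (sym x≡y) xs↭ys)

-- Comparator networks permute their input

lookup≡! : ∀ {n} (v : Vec ℕ n) i → lookup v i ≡ toList v ! toℕ i
lookup≡! (x V.∷ v) F.zero    = refl
lookup≡! (x V.∷ v) (F.suc i) = lookup≡! v i

lookup-fromℕ< : ∀ {n} (v : Vec ℕ n) {p} (p<n : p < n) → lookup v (fromℕ< p<n) ≡ toList v ! p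
lookup-fromℕ< v p<n = trans (lookup≡! v _) (cong (toList v !_) (toℕ-fromℕ< p<n))

!-[]≔-≡ : ∀ {n} (v : Vec ℕ n) i y {p} → toℕ i ≡ p → toList (v [ i ]≔ y) ! p ≡ y
!-[]≔-≡ (x V.∷ v) F.zero    y refl = refl
!-[]≔-≡ (x V.∷ v) (F.suc i) y refl = !-[]≔-≡ v i y refl

!-[]≔-≢ : ∀ {n} (v : Vec ℕ n) i y {p} → toℕ i ≢ p → toList (v [ i ]≔ y) ! p ≡ toList v ! p
!-[]≔-≢ (x V.∷ v) F.zero    y {zero}  i≢p = ⊥-elim (i≢p refl)
!-[]≔-≢ (x V.∷ v) F.zero    y {suc p} i≢p = refl
!-[]≔-≢ (x V.∷ v) (F.suc i) y {zero}  i≢p = refl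
!-[]≔-≢ (x V.∷ v) (F.suc i) y {suc p} i≢p = !-[]≔-≢ v i y (i≢p ∘ cong suc)

lookup∷[]≔-↭ : ∀ {n} (w : Vec ℕ n) j x → lookup w j ∷ toList (w [ j ]≔ x) ↭ x ∷ toList w
lookup∷[]≔-↭ (y V.∷ u) F.zero    x = swap y x ↭-refl
lookup∷[]≔-↭ (y V.∷ u) (F.suc j) x =
  ↭-trans (swap (lookup u j) y ↭-refl) (↭-trans (prep y (lookup∷[]≔-↭ u j x)) (swap y x ↭-refl))

swap-entries-↭ : ∀ {n} (v : Vec ℕ n) i j → toList ((v [ i ]≔ lookup v j) [ j ]≔ lookup v i) ↭ toList v
swap-entries-↭ (x V.∷ w) F.zero    F.zero    = ↭-refl
swap-entries-↭ (x V.∷ w) F.zero    (F.suc j) = lookup∷[]≔-↭ w j x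
swap-entries-↭ (x V.∷ w) (F.suc i) F.zero    = lookup∷[]≔-↭ w i x
swap-entries-↭ (x V.∷ w) (F.suc i) (F.suc j) = prep x (swap-entries-↭ w i j)

applyC-↭ : ∀ {m} (c : Comparator m) v → toList (applyC c v) ↭ toList v
applyC-↭ (cmp i j i<j j<m) v with ≤-total (lookup v (fromℕ< (<-trans i<j j<m))) (lookup v (fromℕ< j<m))
... | inj₁ x≤y rewrite m≤n⇒m⊔n≡n x≤y | m≤n⇒m⊓n≡m x≤y = swap-entries-↭ v _ _
... | inj₂ y≤x rewrite m≥n⇒m⊔n≡m y≤x | m≥n⇒m⊓n≡n y≤x
                     | []≔-lookup v (fromℕ< (<-trans i<j j<m)) | []≔-lookup v (fromℕ< j<m) = ↭-refl

run-↭ : ∀ {m} (N : Network m) v → toList (run N v) ↭ toList v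
run-↭ []      v = ↭-refl
run-↭ (c ∷ N) v = ↭-trans (run-↭ N (applyC c v)) (applyC-↭ c v)

module _ {m} (v : Vec ℕ m) {i j} (i<j : i < j) (j<m : j < m) where

  private
    fi fj : Fin m
    fi = fromℕ< (<-trans i<j j<m)
    fj = fromℕ< j<m

    v₁ : Vec ℕ m
    v₁ = v [ fi ]≔ (lookup v fi ⊔ lookup v fj)

    fi≡i : toℕ fi ≡ i
    fi≡i = toℕ-fromℕ< (<-trans i<j j<m)

    fj≡j : toℕ fj ≡ j
    fj≡j = toℕ-fromℕ< j<m

  applyC-max : toList (applyC (cmp i j i<j j<m) v) ! i ≡ toList v ! i ⊔ toList v ! j
  applyC-max = trans (!-[]≔-≢ v₁ fj _ (λ j≡i → <-irrefl (trans (sym j≡i) fj≡j) i<j))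
                     (trans (!-[]≔-≡ v fi _ fi≡i)
                            (cong₂ _⊔_ (lookup-fromℕ< v (<-trans i<j j<m)) (lookup-fromℕ< v j<m)))

  applyC-min : toList (applyC (cmp i j i<j j<m) v) ! j ≡ toList v ! i ⊓ toList v ! j
  applyC-min = trans (!-[]≔-≡ v₁ fj _ fj≡j)
                     (cong₂ _⊓_ (lookup-fromℕ< v (<-trans i<j j<m)) (lookup-fromℕ< v j<m))

  applyC-other : ∀ {p} → p ≢ i → p ≢ j → toList (applyC (cmp i j i<j j<m) v) ! p ≡ toList v ! p
  applyC-other p≢i p≢j =
    trans (!-[]≔-≢ v₁ fj _ (λ j≡p → p≢j (trans (sym j≡p) fj≡j)))
          (!-[]≔-≢ v fi _ (λ i≡p → p≢i (trans (sym i≡p) fi≡i)))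

-- The 0-1 image of a network

Bits : Set
Bits = ℕ → Bool

cmpᵇ : ℕ × ℕ → Bits → Bits
cmpᵇ (i , j) β p with p ≟ i
... | yes _ = β i ∨ β j
... | no  _ with p ≟ j
...   | yes _ = β i ∧ β j
...   | no  _ = β p

runᵇ : List (ℕ × ℕ) → Bits → Bits
runᵇ []       β = β
runᵇ (c ∷ cs) β = runᵇ cs (cmpᵇ c β)

ends : ∀ {m} → Comparator m → ℕ × ℕ
ends c = Comparator.i c , Comparator.j c

wires : ∀ {m} → Network m → List (ℕ × ℕ)
wires = L.map ends

cmpᵇ-max : ∀ i j β → cmpᵇ (i , j) β i ≡ β i ∨ β j
cmpᵇ-max i j β with i ≟ i
... | yes _   = refl
... | no  i≢i = ⊥-elim (i≢i refl)

cmpᵇ-min : ∀ {i j} β → i ≢ j → cmpᵇ (i , j) β j ≡ β i ∧ β j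
cmpᵇ-min {i} {j} β i≢j with j ≟ i
... | yes j≡i = ⊥-elim (i≢j (sym j≡i))
... | no  _ with j ≟ j
...   | yes _   = refl
...   | no  j≢j = ⊥-elim (j≢j refl)

cmpᵇ-other : ∀ {i j} β {p} → p ≢ i → p ≢ j → cmpᵇ (i , j) β p ≡ β p
cmpᵇ-other {i} {j} β {p} p≢i p≢j with p ≟ i
... | yes p≡i = ⊥-elim (p≢i p≡i)
... | no  _ with p ≟ j
...   | yes p≡j = ⊥-elim (p≢j p≡j)
...   | no  _   = refl

cmpᵇ-cong : ∀ c {β β'} → β ≗ β' → cmpᵇ c β ≗ cmpᵇ c β'
cmpᵇ-cong (i , j) β≗β' p with p ≟ i
... | yes _ = cong₂ _∨_ (β≗β' i) (β≗β' j)
... | no  _ with p ≟ j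
...   | yes _ = cong₂ _∧_ (β≗β' i) (β≗β' j)
...   | no  _ = β≗β' p

runᵇ-cong : ∀ cs {β β'} → β ≗ β' → runᵇ cs β ≗ runᵇ cs β'
runᵇ-cong []       β≗β' = β≗β'
runᵇ-cong (c ∷ cs) β≗β' = runᵇ-cong cs (cmpᵇ-cong c β≗β')

runᵇ-++ : ∀ cs ds β → runᵇ (cs L.++ ds) β ≡ runᵇ ds (runᵇ cs β)
runᵇ-++ []       ds β = refl
runᵇ-++ (c ∷ cs) ds β = runᵇ-++ cs ds (cmpᵇ c β)

∨-absorbs-implied : ∀ {a b} → (b ≡ true → a ≡ true) → a ∨ b ≡ a
∨-absorbs-implied {true}          _     = refl
∨-absorbs-implied {false} {false} _     = refl
∨-absorbs-implied {false} {true}  b⇒a = sym (b⇒a refl)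

∧-absorbs-implied : ∀ {a b} → (a ≡ true → b ≡ true) → a ∧ b ≡ a
∧-absorbs-implied {false} _     = refl
∧-absorbs-implied {true}  a⇒b = a⇒b refl

∧-true⁻¹ˡ : ∀ {a b} → a ∧ b ≡ true → a ≡ true
∧-true⁻¹ˡ {true} _ = refl

∧-true⁻¹ʳ : ∀ {a b} → a ∧ b ≡ true → b ≡ true
∧-true⁻¹ʳ {true} b≡1 = b≡1

≤ᵇ-true : ∀ {x y} → x ≤ y → (x ≤ᵇ y) ≡ true
≤ᵇ-true x≤y = Equivalence.to T-≡ (≤⇒≤ᵇ x≤y)

≤ᵇ-true⁻¹ : ∀ {x y} → (x ≤ᵇ y) ≡ true → x ≤ y
≤ᵇ-true⁻¹ {x} {y} x≤ᵇy = ≤ᵇ⇒≤ x y (Equivalence.from T-≡ x≤ᵇy)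

<ᵇ-true : ∀ {p a} → p < a → (p <ᵇ a) ≡ true
<ᵇ-true p<a = Equivalence.to T-≡ (<⇒<ᵇ p<a)

<ᵇ-true⁻¹ : ∀ {p a} → (p <ᵇ a) ≡ true → p < a
<ᵇ-true⁻¹ {p} {a} p<ᵇa = <ᵇ⇒< p a (Equivalence.from T-≡ p<ᵇa)

<ᵇ-false : ∀ {p a} → a ≤ p → (p <ᵇ a) ≡ false
<ᵇ-false {p} {a} a≤p with p <ᵇ a in p<ᵇa
... | false = refl
... | true  = ⊥-elim (<⇒≱ (<ᵇ-true⁻¹ p<ᵇa) a≤p)

≤ᵇ-monoʳ : ∀ {x a b} → a ≤ b → (x ≤ᵇ a) ≡ true → (x ≤ᵇ b) ≡ true
≤ᵇ-monoʳ {x} a≤b x≤ᵇa = ≤ᵇ-true (≤-trans (≤ᵇ-true⁻¹ {x} x≤ᵇa) a≤b)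

≤ᵇ-⊔ : ∀ x a b → (x ≤ᵇ a ⊔ b) ≡ (x ≤ᵇ a) ∨ (x ≤ᵇ b)
≤ᵇ-⊔ x a b with ≤-total a b
... | inj₁ a≤b rewrite m≤n⇒m⊔n≡n a≤b =
  sym (trans (∨-comm (x ≤ᵇ a) _) (∨-absorbs-implied (≤ᵇ-monoʳ {x} a≤b)))
... | inj₂ b≤a rewrite m≥n⇒m⊔n≡m b≤a = sym (∨-absorbs-implied (≤ᵇ-monoʳ {x} b≤a))

≤ᵇ-⊓ : ∀ x a b → (x ≤ᵇ a ⊓ b) ≡ (x ≤ᵇ a) ∧ (x ≤ᵇ b)
≤ᵇ-⊓ x a b with ≤-total a b
... | inj₁ a≤b rewrite m≤n⇒m⊓n≡m a≤b = sym (∧-absorbs-implied (≤ᵇ-monoʳ {x} a≤b))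
... | inj₂ b≤a rewrite m≥n⇒m⊓n≡n b≤a =
  sym (trans (∧-comm (x ≤ᵇ a) _) (∧-absorbs-implied (≤ᵇ-monoʳ {x} b≤a)))

threshold : ∀ {n} → ℕ → Vec ℕ n → Bits
threshold x v p = x ≤ᵇ toList v ! p

threshold-applyC : ∀ {m} (c : Comparator m) v x → threshold x (applyC c v) ≗ cmpᵇ (ends c) (threshold x v)
threshold-applyC (cmp i j i<j j<m) v x p with p ≟ i
... | yes refl = trans (cong (x ≤ᵇ_) (applyC-max v i<j j<m)) (≤ᵇ-⊔ x _ _)
... | no p≢i with p ≟ j
...   | yes refl = trans (cong (x ≤ᵇ_) (applyC-min v i<j j<m)) (≤ᵇ-⊓ x _ _)
...   | no p≢j   = cong (x ≤ᵇ_) (applyC-other v i<j j<m p≢i p≢j)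

threshold-run : ∀ {m} (N : Network m) v x → threshold x (run N v) ≗ runᵇ (wires N) (threshold x v)
threshold-run []      v x p = refl
threshold-run (c ∷ N) v x p =
  trans (threshold-run N (applyC c v) x p) (runᵇ-cong (wires N) (threshold-applyC c v x) p)

AgreeBelow : ℕ → Bits → Bits → Set
AgreeBelow n β β' = ∀ p → p < n → β p ≡ β' p

AllTrue : ℕ → Bits → Set
AllTrue n β = AgreeBelow n β (λ _ → true)

AllFalse : ℕ → Bits → Set
AllFalse n β = AgreeBelow n β (λ _ → false)

Avoids : ℕ → List (ℕ × ℕ) → Set
Avoids p = All (λ c → p ≢ proj₁ c × p ≢ proj₂ c)

WiresBelow : ℕ → List (ℕ × ℕ) → Set
WiresBelow m = All (λ c → proj₁ c < m × proj₂ c < m)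

WiresFrom : ℕ → List (ℕ × ℕ) → Set
WiresFrom d = All (λ c → d ≤ proj₁ c × d ≤ proj₂ c)

wires-below : ∀ {m} (N : Network m) → WiresBelow m (wires N)
wires-below []                    = []
wires-below (cmp i j i<j j<m ∷ N) = (<-trans i<j j<m , j<m) ∷ wires-below N

WiresBelow⇒Avoids : ∀ {m p cs} → WiresBelow m cs → m ≤ p → Avoids p cs
WiresBelow⇒Avoids []                  _   = []
WiresBelow⇒Avoids ((i<m , j<m) ∷ cs<) m≤p =
  ((λ { refl → <⇒≱ i<m m≤p }) , (λ { refl → <⇒≱ j<m m≤p })) ∷ WiresBelow⇒Avoids cs< m≤p

WiresFrom⇒Avoids : ∀ {d p cs} → WiresFrom d cs → p < d → Avoids p cs
WiresFrom⇒Avoids []                  _   = []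
WiresFrom⇒Avoids ((d≤i , d≤j) ∷ cs≥) p<d =
  ((λ { refl → <⇒≱ p<d d≤i }) , (λ { refl → <⇒≱ p<d d≤j })) ∷ WiresFrom⇒Avoids cs≥ p<d

runᵇ-avoid : ∀ cs β {p} → Avoids p cs → runᵇ cs β p ≡ β p
runᵇ-avoid []             β _                   = refl
runᵇ-avoid ((i , j) ∷ cs) β ((p≢i , p≢j) ∷ av) =
  trans (runᵇ-avoid cs _ av) (cmpᵇ-other β p≢i p≢j)

cmpᵇ-agree : ∀ {m i j β β'} → i < m → j < m → AgreeBelow m β β' →
             AgreeBelow m (cmpᵇ (i , j) β) (cmpᵇ (i , j) β')
cmpᵇ-agree {i = i} {j} i<m j<m β≈β' p p<m with p ≟ i
... | yes _ = cong₂ _∨_ (β≈β' i i<m) (β≈β' j j<m)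
... | no  _ with p ≟ j
...   | yes _ = cong₂ _∧_ (β≈β' i i<m) (β≈β' j j<m)
...   | no  _ = β≈β' p p<m

runᵇ-agree : ∀ {m} cs {β β'} → WiresBelow m cs → AgreeBelow m β β' →
             AgreeBelow m (runᵇ cs β) (runᵇ cs β')
runᵇ-agree []             _                   β≈β' = β≈β'
runᵇ-agree ((i , j) ∷ cs) ((i<m , j<m) ∷ cs<) β≈β' = runᵇ-agree cs cs< (cmpᵇ-agree i<m j<m β≈β')

runᵇ-const : ∀ cs b → runᵇ cs (λ _ → b) ≗ (λ _ → b)
runᵇ-const []             b p = refl
runᵇ-const ((i , j) ∷ cs) b p = trans (runᵇ-cong cs cmpᵇ-const p) (runᵇ-const cs b p)
  where
  cmpᵇ-const : cmpᵇ (i , j) (λ _ → b) ≗ (λ _ → b)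
  cmpᵇ-const q with q ≟ i
  ... | yes _ = ∨-idem b
  ... | no  _ with q ≟ j
  ...   | yes _ = ∧-idem b
  ...   | no  _ = refl

runᵇ-allTrue : ∀ {m} cs {β} → WiresBelow m cs → AllTrue m β → AllTrue m (runᵇ cs β)
runᵇ-allTrue cs cs< β≈1 p p<m = trans (runᵇ-agree cs cs< β≈1 p p<m) (runᵇ-const cs true p)

runᵇ-allFalse : ∀ {m} cs {β} → WiresBelow m cs → AllFalse m β → AllFalse m (runᵇ cs β)
runᵇ-allFalse cs cs< β≈0 p p<m = trans (runᵇ-agree cs cs< β≈0 p p<m) (runᵇ-const cs false p)

shiftᵇ : ℕ → Bits → Bits
shiftᵇ d β q = β (d + q)

shiftWire : ℕ → ℕ × ℕ → ℕ × ℕ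
shiftWire d (i , j) = d + i , d + j

cmpᵇ-shift : ∀ d c β → shiftᵇ d (cmpᵇ (shiftWire d c) β) ≗ cmpᵇ c (shiftᵇ d β)
cmpᵇ-shift d (i , j) β q with q ≟ i
... | yes refl = cmpᵇ-max (d + q) (d + j) β
... | no q≢i with q ≟ j
...   | yes refl = cmpᵇ-min β (q≢i ∘ sym ∘ +-cancelˡ-≡ d i q)
...   | no  q≢j  = cmpᵇ-other β (q≢i ∘ +-cancelˡ-≡ d q i) (q≢j ∘ +-cancelˡ-≡ d q j)

runᵇ-shift : ∀ d cs β → shiftᵇ d (runᵇ (L.map (shiftWire d) cs) β) ≗ runᵇ cs (shiftᵇ d β)
runᵇ-shift d []       β q = refl
runᵇ-shift d (c ∷ cs) β q =
  trans (runᵇ-shift d cs (cmpᵇ (shiftWire d c) β) q) (runᵇ-cong cs (cmpᵇ-shift d c β) q)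

shifted-from : ∀ d cs → WiresFrom d (L.map (shiftWire d) cs)
shifted-from d []             = []
shifted-from d ((i , j) ∷ cs) = (m≤m+n d i , m≤m+n d j) ∷ shifted-from d cs

wires-widen : ∀ {m m'} {m≤m' : m ≤ m'} (N : Network m) → wires (L.map (widenC m≤m') N) ≡ wires N
wires-widen []                = refl
wires-widen (cmp i j _ _ ∷ N) = cong ((i , j) ∷_) (wires-widen N)

wires-∥ : ∀ {m m'} (N : Network m) (N' : Network m') →
          wires (N ∥ N') ≡ wires N L.++ L.map (shiftWire m) (wires N')
wires-∥ {m} N N' = trans (map-++ ends (L.map (widenC _) N) (L.map (shiftC m) N'))
                         (cong₂ L._++_ (wires-widen N) (wires-shift N'))
  where
  wires-shift : ∀ {m'} (N' : Network m') → wires (L.map (shiftC m) N') ≡ L.map (shiftWire m) (wires N')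
  wires-shift []                  = refl
  wires-shift (cmp i j _ _ ∷ N') = cong ((m + i , m + j) ∷_) (wires-shift N')

runᵇ-∥-left : ∀ {m m'} (N : Network m) (N' : Network m') β {p} → p < m →
              runᵇ (wires (N ∥ N')) β p ≡ runᵇ (wires N) β p
runᵇ-∥-left {m} N N' β p<m
  rewrite wires-∥ N N' | runᵇ-++ (wires N) (L.map (shiftWire m) (wires N')) β =
  runᵇ-avoid _ _ (WiresFrom⇒Avoids (shifted-from m (wires N')) p<m)

runᵇ-∥-right : ∀ {m m'} (N : Network m) (N' : Network m') β →
               shiftᵇ m (runᵇ (wires (N ∥ N')) β) ≗ runᵇ (wires N') (shiftᵇ m β)
runᵇ-∥-right {m} N N' β q
  rewrite wires-∥ N N' | runᵇ-++ (wires N) (L.map (shiftWire m) (wires N')) β =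
  trans (runᵇ-shift m (wires N') (runᵇ (wires N) β) q)
        (runᵇ-cong (wires N') N-untouched q)
  where
  N-untouched : shiftᵇ m (runᵇ (wires N) β) ≗ shiftᵇ m β
  N-untouched r = runᵇ-avoid (wires N) β (WiresBelow⇒Avoids (wires-below N) (m≤m+n m r))

layer : ∀ {n} → (Fin n → ℕ) → (Fin n → ℕ) → List (ℕ × ℕ)
layer I J = tabulate (λ t → I t , J t)

wires-tabulate : ∀ {m n} (C : Fin n → Comparator m) → wires (L.map C (allFin n)) ≡ tabulate (ends ∘ C)
wires-tabulate C = trans (cong (L.map ends) (map-tabulate id C)) (map-tabulate C ends)

layer-other : ∀ {n} (I J : Fin n → ℕ) β {p} → (∀ t → p ≢ I t) → (∀ t → p ≢ J t) →
              runᵇ (layer I J) β p ≡ β p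
layer-other {zero}  I J β p∉I p∉J = refl
layer-other {suc n} I J β p∉I p∉J =
  trans (layer-other (I ∘ F.suc) (J ∘ F.suc) _ (p∉I ∘ F.suc) (p∉J ∘ F.suc))
        (cmpᵇ-other β (p∉I F.zero) (p∉J F.zero))

layer-ends : ∀ {n} (I J : Fin n → ℕ) → (∀ {t t'} → I t ≡ I t' → t ≡ t') →
             (∀ {t t'} → J t ≡ J t' → t ≡ t') → (∀ t t' → I t ≢ J t') → ∀ β t →
             runᵇ (layer I J) β (I t) ≡ β (I t) ∨ β (J t) × runᵇ (layer I J) β (J t) ≡ β (I t) ∧ β (J t)
layer-ends I J I-inj J-inj I≢J β F.zero =
    trans (layer-other (I ∘ F.suc) (J ∘ F.suc) _ (λ _ → FinP.0≢1+n ∘ I-inj) (λ t → I≢J F.zero (F.suc t)))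
          (cmpᵇ-max _ _ β)
  , trans (layer-other (I ∘ F.suc) (J ∘ F.suc) _ (λ t → I≢J (F.suc t) F.zero ∘ sym) (λ _ → FinP.0≢1+n ∘ J-inj))
          (cmpᵇ-min β (I≢J F.zero F.zero))
layer-ends I J I-inj J-inj I≢J β (F.suc t)
  with layer-ends (I ∘ F.suc) (J ∘ F.suc) (FinP.suc-injective ∘ I-inj) (FinP.suc-injective ∘ J-inj)
                  (λ t t' → I≢J (F.suc t) (F.suc t')) (cmpᵇ (I F.zero , J F.zero) β) t
... | max≡ , min≡ = trans max≡ (cong₂ _∨_ Iₜ-untouched Jₜ-untouched) , trans min≡ (cong₂ _∧_ Iₜ-untouched Jₜ-untouched)
  where
  Iₜ-untouched : cmpᵇ (I F.zero , J F.zero) β (I (F.suc t)) ≡ β (I (F.suc t))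
  Iₜ-untouched = cmpᵇ-other β (FinP.0≢1+n ∘ I-inj ∘ sym) (I≢J (F.suc t) F.zero)
  Jₜ-untouched : cmpᵇ (I F.zero , J F.zero) β (J (F.suc t)) ≡ β (J (F.suc t))
  Jₜ-untouched = cmpᵇ-other β (I≢J F.zero (F.suc t) ∘ sym) (FinP.0≢1+n ∘ J-inj ∘ sym)

wires-split : ∀ h → wires (split h) ≡ layer (λ t → toℕ t) (λ t → h + toℕ t)
wires-split h = wires-tabulate _

split-ends : ∀ h β {p} → p < h →
             runᵇ (wires (split h)) β p ≡ β p ∨ β (h + p) × runᵇ (wires (split h)) β (h + p) ≡ β p ∧ β (h + p)
split-ends h β p<h rewrite wires-split h
  with layer-ends (λ t → toℕ t) (λ t → h + toℕ t) toℕ-injective (toℕ-injective ∘ +-cancelˡ-≡ h _ _)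
                  (λ t t' → <⇒≢ (<-≤-trans (toℕ<n t) (m≤m+n h (toℕ t')))) β (fromℕ< p<h)
... | max≡ , min≡ rewrite toℕ-fromℕ< p<h = max≡ , min≡

wires-halfSplit : ∀ q → wires (halfSplit q) ≡ layer (λ t → q + toℕ t) (λ t → (q + q) + (q + toℕ t))
wires-halfSplit q = wires-tabulate _

halfSplit-ends : ∀ q β {p} → p < q →
  runᵇ (wires (halfSplit q)) β (q + p) ≡ β (q + p) ∨ β ((q + q) + (q + p)) ×
  runᵇ (wires (halfSplit q)) β ((q + q) + (q + p)) ≡ β (q + p) ∧ β ((q + q) + (q + p))
halfSplit-ends q β p<q rewrite wires-halfSplit q
  with layer-ends (λ t → q + toℕ t) (λ t → (q + q) + (q + toℕ t))
                  (toℕ-injective ∘ +-cancelˡ-≡ q _ _) (toℕ-injective ∘ +-cancelˡ-≡ q _ _ ∘ +-cancelˡ-≡ (q + q) _ _)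
                  (λ t t' → <⇒≢ (<-≤-trans (+-monoʳ-< q (toℕ<n t)) (m≤m+n (q + q) (q + toℕ t'))))
                  β (fromℕ< p<q)
... | max≡ , min≡ rewrite toℕ-fromℕ< p<q = max≡ , min≡

halfSplit-skips : ∀ q β {p} → p < q →
  runᵇ (wires (halfSplit q)) β p ≡ β p × runᵇ (wires (halfSplit q)) β ((q + q) + p) ≡ β ((q + q) + p)
halfSplit-skips q β {p} p<q rewrite wires-halfSplit q =
    layer-other {q} _ _ β (λ t → <⇒≢ (<-≤-trans p<q (m≤m+n q (toℕ t))))
                      (λ t → <⇒≢ (<-≤-trans p<q (≤-trans (m≤m+n q q) (m≤m+n (q + q) (q + toℕ t)))))
  , layer-other {q} _ _ β (λ t → >⇒≢ (<-≤-trans (+-monoʳ-< q (toℕ<n t)) (m≤m+n (q + q) p)))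
                      (λ t → <⇒≢ (+-monoʳ-< (q + q) (<-≤-trans p<q (m≤m+n q (toℕ t)))))

-- Bitonic 0-1 sequences

<ᵇ-+ : ∀ M {p a} → (M + p <ᵇ M + a) ≡ (p <ᵇ a)
<ᵇ-+ zero    = refl
<ᵇ-+ (suc M) = <ᵇ-+ M

<ᵇ-+-∸ : ∀ M {p a} → M ≤ a → (M + p <ᵇ a) ≡ (p <ᵇ a ∸ M)
<ᵇ-+-∸ M {p} M≤a = trans (cong (M + p <ᵇ_) (sym (m+[n∸m]≡n M≤a))) (<ᵇ-+ M)

-- valley a b = 1ᵃ 0ᵇ⁻ᵃ 1 1 1 …  and  hill a b = 0ᵃ 1ᵇ⁻ᵃ 0 0 0 …
valley : ℕ → ℕ → Bits
valley a b p = (p <ᵇ a) ∨ not (p <ᵇ b)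

hill : ℕ → ℕ → Bits
hill a b p = not (p <ᵇ a) ∧ (p <ᵇ b)

IsValley : ℕ → Bits → ℕ → ℕ → Set
IsValley n β a b = a ≤ b × b ≤ n × AgreeBelow n β (valley a b)

IsHill : ℕ → Bits → ℕ → ℕ → Set
IsHill n β a b = a ≤ b × b ≤ n × AgreeBelow n β (hill a b)

Bitonic : ℕ → Bits → Set
Bitonic n β = ∃₂ λ a b → IsValley n β a b ⊎ IsHill n β a b

-- The last block of ones is no longer than the first.
LeftHeavyValley : ℕ → Bits → Set
LeftHeavyValley n β = ∃₂ λ a b → IsValley n β a b × n ≤ a + b

SortedBits : ℕ → Bits → Set
SortedBits n β = ∀ p q → p < q → q < n → β q ≡ true → β p ≡ true

orHalves : ℕ → Bits → Bits
orHalves M β p = β p ∨ β (M + p)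

andHalves : ℕ → Bits → Bits
andHalves M β p = β p ∧ β (M + p)

valley-head : ∀ a b {p} → p < a → valley a b p ≡ true
valley-head a b {p} p<a = cong (_∨ not (p <ᵇ b)) (<ᵇ-true p<a)

valley-tail : ∀ a b {p} → b ≤ p → valley a b p ≡ true
valley-tail a b {p} b≤p = trans (cong (λ x → (p <ᵇ a) ∨ not x) (<ᵇ-false b≤p)) (∨-zeroʳ _)

valley-before : ∀ a b {p} → p < b → valley a b p ≡ (p <ᵇ a)
valley-before a b {p} p<b = trans (cong (λ x → (p <ᵇ a) ∨ not x) (<ᵇ-true p<b)) (∨-identityʳ _)

valley-after : ∀ a b {p} → a ≤ p → valley a b p ≡ not (p <ᵇ b)
valley-after a b {p} a≤p = cong (_∨ not (p <ᵇ b)) (<ᵇ-false a≤p)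

valley-shift : ∀ M a b {p} → M ≤ a → M ≤ b → valley a b (M + p) ≡ valley (a ∸ M) (b ∸ M) p
valley-shift M a b M≤a M≤b = cong₂ (λ x y → x ∨ not y) (<ᵇ-+-∸ M M≤a) (<ᵇ-+-∸ M M≤b)

not-valley : ∀ a b p → not (valley a b p) ≡ hill a b p
not-valley a b p with p <ᵇ a | p <ᵇ b
... | true  | _     = refl
... | false | true  = refl
... | false | false = refl

AllTrue⇒IsValley : ∀ {n β} → AllTrue n β → IsValley n β n n
AllTrue⇒IsValley {n} β≈1 = ≤-refl , ≤-refl , λ p p<n → trans (β≈1 p p<n) (sym (valley-head n n p<n))

AllTrue⇒Bitonic : ∀ {n β} → AllTrue n β → Bitonic n β
AllTrue⇒Bitonic {n} β≈1 = n , n , inj₁ (AllTrue⇒IsValley β≈1)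

AllFalse⇒Bitonic : ∀ {n β} → AllFalse n β → Bitonic n β
AllFalse⇒Bitonic β≈0 = 0 , 0 , inj₂ (z≤n , z≤n , β≈0)

module ValleySplit (M : ℕ) (β : Bits) {a b : ℕ} (a≤b : a ≤ b) (b≤2M : b ≤ M + M)
                   (β≈ : AgreeBelow (M + M) β (valley a b)) where

  private
    left : ∀ {p} → p < M → β p ≡ valley a b p
    left {p} p<M = β≈ p (<-≤-trans p<M (m≤m+n M M))

    right : ∀ {p} → p < M → β (M + p) ≡ valley a b (M + p)
    right {p} p<M = β≈ (M + p) (+-monoʳ-< M p<M)

    b∸M≤M : b ∸ M ≤ M
    b∸M≤M = m≤n+o⇒m∸n≤o b M b≤2M

  module Narrow (narrow : b ≤ a + M) where

    orHalves-allTrue : AllTrue M (orHalves M β)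
    orHalves-allTrue p p<M with p <? a
    ... | yes p<a = cong (_∨ β (M + p)) (trans (left p<M) (valley-head a b p<a))
    ... | no  p≮a = trans (cong (β p ∨_) (trans (right p<M) (valley-tail a b b≤M+p))) (∨-zeroʳ _)
      where
      b≤M+p : b ≤ M + p
      b≤M+p = ≤-trans narrow (≤-trans (≤-reflexive (+-comm a M)) (+-monoʳ-≤ M (≮⇒≥ p≮a)))

    andHalves-bitonic : Bitonic M (andHalves M β)
    andHalves-bitonic with b ≤? M | M ≤? a
    ... | yes b≤M | _ = a , b , inj₁ (a≤b , b≤M , λ p p<M →
      trans (cong₂ _∧_ (left p<M) (trans (right p<M) (valley-tail a b (≤-trans b≤M (m≤m+n M p)))))
            (∧-identityʳ _))
    ... | no _ | yes M≤a = a ∸ M , b ∸ M , inj₁ (∸-monoˡ-≤ M a≤b , b∸M≤M , λ p p<M →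
      cong₂ _∧_ (trans (left p<M) (valley-head a b (<-≤-trans p<M M≤a)))
                (trans (right p<M) (valley-shift M a b M≤a (≤-trans M≤a a≤b))))
    ... | no b≰M | no M≰a = b ∸ M , a , inj₂ (b∸M≤a , <⇒≤ a<M , λ p p<M →
      trans (cong₂ _∧_ (trans (left p<M) (valley-before a b (<-trans p<M M<b)))
                       (trans (right p<M) (trans (valley-after a b (≤-trans (<⇒≤ a<M) (m≤m+n M p)))
                                                 (cong not (<ᵇ-+-∸ M (<⇒≤ M<b))))))
            (∧-comm (p <ᵇ a) _))
      where
      a<M : a < M
      a<M = ≰⇒> M≰a
      M<b : M < b
      M<b = ≰⇒> b≰M
      b∸M≤a : b ∸ M ≤ a
      b∸M≤a = m≤n+o⇒m∸n≤o b M (≤-trans narrow (≤-reflexive (+-comm a M)))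

  module Wide (wide : a + M < b) where

    private
      a<M : a < M
      a<M = +-cancelʳ-< M a M (<-≤-trans wide b≤2M)

      M<b : M < b
      M<b = ≤-<-trans (m≤n+m M a) wide

      upper-after-a : ∀ {p} → p < M → β (M + p) ≡ not (p <ᵇ b ∸ M)
      upper-after-a {p} p<M = trans (right p<M) (trans (valley-after a b (≤-trans (<⇒≤ a<M) (m≤m+n M p)))
                                                       (cong not (<ᵇ-+-∸ M (<⇒≤ M<b))))

      lower-before-b : ∀ {p} → p < M → β p ≡ (p <ᵇ a)
      lower-before-b p<M = trans (left p<M) (valley-before a b (<-trans p<M M<b))

    andHalves-allFalse : AllFalse M (andHalves M β)
    andHalves-allFalse p p<M with p <? a
    ... | yes p<a = trans (cong (β p ∧_) (trans (upper-after-a p<M) (cong not (<ᵇ-true p<b∸M)))) (∧-zeroʳ _)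
      where
      p<b∸M : p < b ∸ M
      p<b∸M = m+n≤o⇒m≤o∸n (suc p) (≤-trans (+-monoˡ-≤ M p<a) (<⇒≤ wide))
    ... | no  p≮a = cong (_∧ β (M + p)) (trans (lower-before-b p<M) (<ᵇ-false (≮⇒≥ p≮a)))

    orHalves-valley : IsValley M (orHalves M β) a (b ∸ M)
    orHalves-valley = m+n≤o⇒m≤o∸n a (<⇒≤ wide) , b∸M≤M , λ p p<M →
      cong₂ _∨_ (lower-before-b p<M) (upper-after-a p<M)

split-valley : ∀ M β {a b} → IsValley (M + M) β a b →
  AllTrue M (orHalves M β) × Bitonic M (andHalves M β) ⊎
  AllFalse M (andHalves M β) × IsValley M (orHalves M β) a (b ∸ M)
split-valley M β {a} {b} (a≤b , b≤2M , β≈) with b ≤? a + M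
... | yes narrow = inj₁ (orHalves-allTrue , andHalves-bitonic)
  where open ValleySplit M β a≤b b≤2M β≈
        open Narrow narrow
... | no  b≰a+M = inj₂ (andHalves-allFalse , orHalves-valley)
  where open ValleySplit M β a≤b b≤2M β≈
        open Wide (≰⇒> b≰a+M)

Bitonic-complement : ∀ {n β β'} → AgreeBelow n β' (not ∘ β) → Bitonic n β' → Bitonic n β
Bitonic-complement {β = β} β'≈¬β (a , b , inj₁ (a≤b , b≤n , β'≈)) =
  a , b , inj₂ (a≤b , b≤n , λ p p<n →
    trans (sym (not-involutive (β p)))
          (trans (cong not (trans (sym (β'≈¬β p p<n)) (β'≈ p p<n))) (not-valley a b p)))
Bitonic-complement {β = β} β'≈¬β (a , b , inj₂ (a≤b , b≤n , β'≈)) =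
  a , b , inj₁ (a≤b , b≤n , λ p p<n →
    not-injective (trans (sym (β'≈¬β p p<n)) (trans (β'≈ p p<n) (sym (not-valley a b p)))))

split-bitonic : ∀ M β → Bitonic (M + M) β →
  Bitonic M (orHalves M β) × Bitonic M (andHalves M β) ×
  (AllTrue M (orHalves M β) ⊎ AllFalse M (andHalves M β))
split-bitonic M β (a , b , inj₁ β-valley) with split-valley M β β-valley
... | inj₁ (or≈1 , and-bitonic) = AllTrue⇒Bitonic or≈1 , and-bitonic , inj₁ or≈1
... | inj₂ (and≈0 , or-valley)  = (a , b ∸ M , inj₁ or-valley) , AllFalse⇒Bitonic and≈0 , inj₂ and≈0
split-bitonic M β (a , b , inj₂ (a≤b , b≤2M , β≈)) with split-valley M (not ∘ β) (a≤b , b≤2M , ¬β≈)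
  where
  ¬β≈ : AgreeBelow (M + M) (not ∘ β) (valley a b)
  ¬β≈ p p< = trans (cong not (trans (β≈ p p<) (sym (not-valley a b p)))) (not-involutive _)
... | inj₁ (or¬≈1 , and¬-bitonic) =
  Bitonic-complement and¬≈¬or and¬-bitonic , AllFalse⇒Bitonic and≈0 , inj₂ and≈0
  where
  and¬≈¬or : AgreeBelow M (andHalves M (not ∘ β)) (not ∘ orHalves M β)
  and¬≈¬or p _ = sym (deMorgan₂ (β p) (β (M + p)))
  and≈0 : AllFalse M (andHalves M β)
  and≈0 p p<M = not-injective (trans (deMorgan₁ (β p) (β (M + p))) (or¬≈1 p p<M))
... | inj₂ (and¬≈0 , or¬-valley) =
  AllTrue⇒Bitonic or≈1 , Bitonic-complement or¬≈¬and (a , b ∸ M , inj₁ or¬-valley) , inj₁ or≈1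
  where
  or¬≈¬and : AgreeBelow M (orHalves M (not ∘ β)) (not ∘ andHalves M β)
  or¬≈¬and p _ = sym (deMorgan₁ (β p) (β (M + p)))
  or≈1 : AllTrue M (orHalves M β)
  or≈1 p p<M = not-injective (trans (deMorgan₂ (β p) (β (M + p))) (and¬≈0 p p<M))

SortedBits-resp : ∀ {n β β'} → AgreeBelow n β β' → SortedBits n β' → SortedBits n β
SortedBits-resp β≈β' sorted p q p<q q<n βq =
  trans (β≈β' p (<-trans p<q q<n)) (sorted p q p<q q<n (trans (sym (β≈β' q q<n)) βq))

SortedBits-halves : ∀ {M β} → SortedBits M β → SortedBits M (shiftᵇ M β) →
                    AllTrue M β ⊎ AllFalse M (shiftᵇ M β) → SortedBits (M + M) β
SortedBits-halves {M} sortedL sortedR extreme p q p<q q<2M βq with q <? M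
... | yes q<M = sortedL p q p<q q<M βq
... | no  q≮M with m≤n⇒∃[o]m+o≡n (≮⇒≥ q≮M)
...   | q' , refl with p <? M | extreme
...     | yes p<M | inj₁ left≈1 = left≈1 p p<M
...     | yes p<M | inj₂ right≈0 with () ← trans (sym βq) (right≈0 q' (+-cancelˡ-< M q' M q<2M))
...     | no  p≮M | _ with m≤n⇒∃[o]m+o≡n (≮⇒≥ p≮M)
...       | p' , refl =
  sortedR p' q' (+-cancelˡ-< M p' q' p<q) (+-cancelˡ-< M q' M q<2M) βq

runᵇ-wires-++ : ∀ {m} (N N' : Network m) β → runᵇ (wires (N L.++ N')) β ≡ runᵇ (wires N') (runᵇ (wires N) β)
runᵇ-wires-++ N N' β = trans (cong (λ cs → runᵇ cs β) (map-++ ends N N')) (runᵇ-++ (wires N) (wires N') β)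

∥-sorted : ∀ {M} (N N' : Network M) {β βL βR} →
           AgreeBelow M β βL → AgreeBelow M (shiftᵇ M β) βR →
           SortedBits M (runᵇ (wires N) βL) → SortedBits M (runᵇ (wires N') βR) →
           AllTrue M βL ⊎ AllFalse M βR →
           SortedBits (M + M) (runᵇ (wires (N ∥ N')) β)
∥-sorted {M} N N' {β} β≈βL β≈βR sortedL sortedR extreme =
  SortedBits-halves (SortedBits-resp left≈ sortedL) (SortedBits-resp right≈ sortedR) extreme′
  where
  left≈ : AgreeBelow M (runᵇ (wires (N ∥ N')) β) (runᵇ (wires N) _)
  left≈ p p<M = trans (runᵇ-∥-left N N' β p<M) (runᵇ-agree (wires N) (wires-below N) β≈βL p p<M)
  right≈ : AgreeBelow M (shiftᵇ M (runᵇ (wires (N ∥ N')) β)) (runᵇ (wires N') _)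
  right≈ p p<M = trans (runᵇ-∥-right N N' β p) (runᵇ-agree (wires N') (wires-below N') β≈βR p p<M)
  extreme′ : AllTrue M (runᵇ (wires (N ∥ N')) β) ⊎ AllFalse M (shiftᵇ M (runᵇ (wires (N ∥ N')) β))
  extreme′ = Sum.map
    (λ βL≈1 p p<M → trans (left≈ p p<M) (runᵇ-allTrue (wires N) (wires-below N) βL≈1 p p<M))
    (λ βR≈0 p p<M → trans (right≈ p p<M) (runᵇ-allFalse (wires N') (wires-below N') βR≈0 p p<M))
    extreme

bitMerge-sorts : ∀ a β → Bitonic (pow2 a) β → SortedBits (pow2 a) (runᵇ (wires (bitMerge a)) β)
bitMerge-sorts zero    β _ _ zero    () _ _
bitMerge-sorts zero    β _ _ (suc q) _  (s≤s ()) _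
bitMerge-sorts (suc a) β bitonic with split-bitonic (pow2 a) β bitonic
... | or-bitonic , and-bitonic , extreme =
  subst (SortedBits (pow2 (suc a))) (sym (runᵇ-wires-++ (split (pow2 a)) _ β))
    (∥-sorted (bitMerge a) (bitMerge a)
       (λ p p<M → proj₁ (split-ends (pow2 a) β p<M)) (λ p p<M → proj₂ (split-ends (pow2 a) β p<M))
       (bitMerge-sorts a _ or-bitonic) (bitMerge-sorts a _ and-bitonic) extreme)

valley-true⁻¹ : ∀ a b {p} → valley a b p ≡ true → p < a ⊎ b ≤ p
valley-true⁻¹ a b {p} v≡1 with p <? a | b ≤? p
... | yes p<a | _       = inj₁ p<a
... | no  _   | yes b≤p = inj₂ b≤p
... | no  p≮a | no  b≰p with () ← trans (sym v≡1) (trans (valley-after a b (≮⇒≥ p≮a)) (cong not (<ᵇ-true (≰⇒> b≰p))))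

-- So the comparators c(p, 2q + p), p < q, that half_split omits are idle on such inputs.
LeftHeavyValley-quarter : ∀ q β → LeftHeavyValley ((q + q) + (q + q)) β →
                          ∀ {p} → p < q → β ((q + q) + p) ≡ true → β p ≡ true
LeftHeavyValley-quarter q β (a , b , (_ , _ , β≈) , heavy) {p} p<q βMp with p <? a
... | yes p<a = trans (β≈ p p<4q) (valley-head a b p<a)
  where
  p<4q : p < (q + q) + (q + q)
  p<4q = <-≤-trans p<q (≤-trans (m≤m+n q q) (m≤m+n (q + q) (q + q)))
... | no  p≮a with valley-true⁻¹ a b (trans (sym (β≈ _ (+-monoʳ-< (q + q) (<-≤-trans p<q (m≤m+n q q))))) βMp)
...   | inj₁ M+p<a = ⊥-elim (p≮a (≤-<-trans (m≤n+m p (q + q)) M+p<a))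
...   | inj₂ b≤M+p = ⊥-elim (<⇒≱ a+b<4q heavy)
  where
  a+b<4q : a + b < (q + q) + (q + q)
  a+b<4q = begin-strict
    a + b                 ≤⟨ +-mono-≤ (≮⇒≥ p≮a) b≤M+p ⟩
    p + ((q + q) + p)     <⟨ +-mono-< p<q (+-monoʳ-< (q + q) p<q) ⟩
    q + ((q + q) + q)     ≡⟨ trans (+-comm q _) (+-assoc (q + q) q q) ⟩
    (q + q) + (q + q)     ∎
    where open ≤-Reasoning

halfSplit-acts-as-split : ∀ q β → LeftHeavyValley ((q + q) + (q + q)) β →
  AgreeBelow (q + q) (runᵇ (wires (halfSplit q)) β) (orHalves (q + q) β) ×
  AgreeBelow (q + q) (shiftᵇ (q + q) (runᵇ (wires (halfSplit q)) β)) (andHalves (q + q) β)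
halfSplit-acts-as-split q β heavy = left≈ , right≈
  where
  quarter : ∀ {p} → p < q → β ((q + q) + p) ≡ true → β p ≡ true
  quarter = LeftHeavyValley-quarter q β heavy
  left≈ : AgreeBelow (q + q) (runᵇ (wires (halfSplit q)) β) (orHalves (q + q) β)
  left≈ p p<M with p <? q
  ... | yes p<q = trans (proj₁ (halfSplit-skips q β p<q)) (sym (∨-absorbs-implied (quarter p<q)))
  ... | no  p≮q with m≤n⇒∃[o]m+o≡n (≮⇒≥ p≮q)
  ...   | p' , refl = proj₁ (halfSplit-ends q β (+-cancelˡ-< q p' q p<M))
  right≈ : AgreeBelow (q + q) (shiftᵇ (q + q) (runᵇ (wires (halfSplit q)) β)) (andHalves (q + q) β)
  right≈ p p<M with p <? q
  ... | yes p<q = trans (proj₂ (halfSplit-skips q β p<q))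
                        (sym (trans (∧-comm (β p) _) (∧-absorbs-implied (quarter p<q))))
  ... | no  p≮q with m≤n⇒∃[o]m+o≡n (≮⇒≥ p≮q)
  ...   | p' , refl = proj₂ (halfSplit-ends q β (+-cancelˡ-< q p' q p<M))

split-leftHeavyValley : ∀ M β → LeftHeavyValley (M + M) β →
  LeftHeavyValley M (orHalves M β) × Bitonic M (andHalves M β) ×
  (AllTrue M (orHalves M β) ⊎ AllFalse M (andHalves M β))
split-leftHeavyValley M β (a , b , β-valley , heavy) with split-valley M β β-valley
... | inj₁ (or≈1 , and-bitonic) =
  (M , M , AllTrue⇒IsValley or≈1 , m≤m+n M M) , and-bitonic , inj₁ or≈1
... | inj₂ (and≈0 , or-valley) =
  (a , b ∸ M , or-valley , +-cancelʳ-≤ M M _ heavy′) , AllFalse⇒Bitonic and≈0 , inj₂ and≈0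
  where
  heavy′ : M + M ≤ (a + (b ∸ M)) + M
  heavy′ = begin
    M + M             ≤⟨ heavy ⟩
    a + b             ≤⟨ +-monoʳ-≤ a (m≤n+m∸n b M) ⟩
    a + (M + (b ∸ M)) ≡⟨ cong (a +_) (+-comm M _) ⟩
    a + ((b ∸ M) + M) ≡⟨ +-assoc a _ M ⟨
    (a + (b ∸ M)) + M ∎
    where open ≤-Reasoning

halfBitMerge-sorts : ∀ c β → LeftHeavyValley (pow2 (suc c)) β →
                     SortedBits (pow2 (suc c)) (runᵇ (wires (halfBitMerge c)) β)
halfBitMerge-sorts zero β (suc a , b , (_ , _ , β≈) , _) zero (suc zero) _ _ _ = β≈ 0 z<s
halfBitMerge-sorts zero β (zero , b , (_ , _ , β≈) , 2≤b) zero (suc zero) _ _ β1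
  with () ← trans (sym β1) (trans (β≈ 1 (s≤s z<s)) (cong not (<ᵇ-true 2≤b)))
halfBitMerge-sorts zero β _ zero    zero          () _ _
halfBitMerge-sorts zero β _ (suc p) (suc zero)    (s≤s ()) _ _
halfBitMerge-sorts zero β _ _       (suc (suc q)) _ (s≤s (s≤s ())) _
halfBitMerge-sorts (suc c) β heavy with halfSplit-acts-as-split (pow2 c) β heavy
                                      | split-leftHeavyValley (pow2 (suc c)) β heavy
... | left≈ , right≈ | or-heavy , and-bitonic , extreme =
  subst (SortedBits (pow2 (suc (suc c)))) (sym (runᵇ-wires-++ (halfSplit (pow2 c)) _ β))
    (∥-sorted (halfBitMerge c) (bitMerge (suc c)) left≈ right≈
       (halfBitMerge-sorts c _ or-heavy) (bitMerge-sorts (suc c) _ and-bitonic) extreme)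

-- 0-1 analysis of pw_hbit_merge

SortedBits⇒prefix : ∀ n {β} → SortedBits n β → ∃ λ α → α ≤ n × AgreeBelow n β (_<ᵇ α)
SortedBits⇒prefix zero    _      = 0 , z≤n , λ _ ()
SortedBits⇒prefix (suc n) {β} sorted
  with SortedBits⇒prefix n (λ p q p<q q<n → sorted p q p<q (<-trans q<n (n<1+n n))) | β n in βn
... | α , α≤n , β≈ | true = suc n , ≤-refl , β≈′
  where
  β≈′ : AgreeBelow (suc n) β (_<ᵇ suc n)
  β≈′ p p<1+n with m<1+n⇒m<n∨m≡n p<1+n
  ... | inj₁ p<n  = trans (sorted p n p<n (n<1+n n) βn) (sym (<ᵇ-true p<1+n))
  ... | inj₂ refl = trans βn (sym (<ᵇ-true p<1+n))
... | α , α≤n , β≈ | false = α , m≤n⇒m≤1+n α≤n , β≈′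
  where
  β≈′ : AgreeBelow (suc n) β (_<ᵇ α)
  β≈′ p p<1+n with m<1+n⇒m<n∨m≡n p<1+n
  ... | inj₁ p<n  = β≈ p p<n
  ... | inj₂ refl = trans βn (sym (<ᵇ-false α≤n))

AllTrue-prefix⇒≤ : ∀ {n β α m} → AgreeBelow n β (_<ᵇ α) → m ≤ n → AllTrue m β → m ≤ α
AllTrue-prefix⇒≤ {β = β} {α} β≈ m≤n β≈1 = ≮⇒≥ λ α<m →
  <-irrefl refl (<ᵇ-true⁻¹ {α} (trans (sym (β≈ α (<-≤-trans α<m m≤n))) (β≈1 α α<m)))

<ᵇ-complement : ∀ t u γ w → suc t + u ≡ γ + w → (u <ᵇ γ) ≡ not (t <ᵇ w)
<ᵇ-complement t u γ w sum≡ with u <? γ | t <? w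
... | yes u<γ | yes t<w = ⊥-elim (<-irrefl sum≡ (<-≤-trans (+-mono-≤-< t<w u<γ) (≤-reflexive (+-comm w γ))))
... | yes u<γ | no  t≮w rewrite <ᵇ-true u<γ | <ᵇ-false (≮⇒≥ t≮w) = refl
... | no  u≮γ | yes t<w rewrite <ᵇ-false (≮⇒≥ u≮γ) | <ᵇ-true t<w = refl
... | no  u≮γ | no  t≮w = ⊥-elim (<-irrefl (sym sum≡) (≤-<-trans (+-mono-≤ (≮⇒≥ u≮γ) (≮⇒≥ t≮w))
                                                                  (s≤s (≤-reflexive (+-comm u t)))))

valley-full : ∀ a b p → b ≤ a → valley a b p ≡ true
valley-full a b p b≤a with p <? a
... | yes p<a = valley-head a b p<a
... | no  p≮a = valley-tail a b (≤-trans b≤a (≮⇒≥ p≮a))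

module Step1 (d c : ℕ) (k≤h : pow2 (suc c) ≤ pow2 d) (β : Bits) where

  private
    K h : ℕ
    K = pow2 c
    h = pow2 d

    maxWire : Fin K → ℕ
    maxWire t = K + toℕ t

    minWire : Fin K → ℕ
    minWire t = h + toℕ (opposite t)

    wires-step1 : wires (pwStep1 d c k≤h) ≡ layer maxWire minWire
    wires-step1 = wires-tabulate _

    maxWire<h : ∀ t → maxWire t < h
    maxWire<h t = <-≤-trans (+-monoʳ-< K (toℕ<n t)) k≤h

    step1-ends : ∀ t → runᵇ (wires (pwStep1 d c k≤h)) β (maxWire t) ≡ β (maxWire t) ∨ β (minWire t) ×
                       runᵇ (wires (pwStep1 d c k≤h)) β (minWire t) ≡ β (maxWire t) ∧ β (minWire t)
    step1-ends t rewrite wires-step1 =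
      layer-ends maxWire minWire (toℕ-injective ∘ +-cancelˡ-≡ K _ _)
        (λ {t} {t'} eq → trans (sym (opposite-involutive t))
          (trans (cong opposite (toℕ-injective (+-cancelˡ-≡ h _ _ eq))) (opposite-involutive t')))
        (λ t t' → <⇒≢ (<-≤-trans (maxWire<h t) (m≤m+n h _))) β t

  β₁ : Bits
  β₁ = runᵇ (wires (pwStep1 d c k≤h)) β

  step1-max : ∀ {t} → t < K → β₁ (K + t) ≡ β (K + t) ∨ β (h + (K ∸ suc t))
  step1-max t<K with proj₁ (step1-ends (fromℕ< t<K))
  ... | max≡ rewrite toℕ-fromℕ< t<K | opposite-prop (fromℕ< t<K) | toℕ-fromℕ< t<K = max≡

  step1-min : ∀ {s} → s < K → β₁ (h + s) ≡ β (K + (K ∸ suc s)) ∧ β (h + s)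
  step1-min s<K with proj₂ (step1-ends (opposite (fromℕ< s<K)))
  ... | min≡ rewrite opposite-involutive (fromℕ< s<K) | toℕ-fromℕ< s<K
                   | opposite-prop (fromℕ< s<K) | toℕ-fromℕ< s<K = min≡

  step1-skips : ∀ {p} → p < K ⊎ (K + K ≤ p × p < h) ⊎ h + K ≤ p → β₁ p ≡ β p
  step1-skips {p} where-p rewrite wires-step1 = layer-other maxWire minWire β (∉maxWire where-p) (∉minWire where-p)
    where
    ∉maxWire : p < K ⊎ (K + K ≤ p × p < h) ⊎ h + K ≤ p → ∀ t → p ≢ maxWire t
    ∉maxWire (inj₁ p<K)               t refl = <⇒≱ p<K (m≤m+n K _)
    ∉maxWire (inj₂ (inj₁ (KK≤p , _))) t refl = <⇒≱ (+-monoʳ-< K (toℕ<n t)) KK≤p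
    ∉maxWire (inj₂ (inj₂ h+K≤p))      t refl = <⇒≱ (maxWire<h t) (≤-trans (m≤m+n h K) h+K≤p)
    ∉minWire : p < K ⊎ (K + K ≤ p × p < h) ⊎ h + K ≤ p → ∀ t → p ≢ minWire t
    ∉minWire (inj₁ p<K)               t refl = <⇒≱ p<K (≤-trans (≤-trans (m≤m+n K K) k≤h) (m≤m+n h _))
    ∉minWire (inj₂ (inj₁ (_ , p<h)))  t refl = <⇒≱ p<h (m≤m+n h _)
    ∉minWire (inj₂ (inj₂ h+K≤p))      t refl = <⇒≱ (+-monoʳ-< h (toℕ<n (opposite t))) h+K≤p

module PwHbitMergeOnBits (d c : ℕ) (k≤h : pow2 (suc c) ≤ pow2 d) (β : Bits)
  (left-top : ∀ p q → p < q → q < pow2 d → p < pow2 (suc c) → β q ≡ true → β p ≡ true)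
  (right-top : ∀ p q → p < q → q < pow2 d → p < pow2 c → β (pow2 d + q) ≡ true → β (pow2 d + p) ≡ true)
  (left≥right : ∀ p → p < pow2 c → β (pow2 d + p) ≡ true → β p ≡ true) where

  open Step1 d c k≤h β

  private
    K KK h : ℕ
    K = pow2 c
    KK = K + K
    h = pow2 d

    K≤h : K ≤ h
    K≤h = ≤-trans (m≤m+n K K) k≤h

    -- α ones open the first k wires of l̄, γ ones the first k/2 wires of r̄.
    left-prefix : ∃ λ α → α ≤ KK × AgreeBelow KK β (_<ᵇ α)
    left-prefix = SortedBits⇒prefix KK λ p q p<q q<KK →
      left-top p q p<q (<-≤-trans q<KK k≤h) (<-trans p<q q<KK)

    right-prefix : ∃ λ γ → γ ≤ K × AgreeBelow K (β ∘ (h +_)) (_<ᵇ γ)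
    right-prefix = SortedBits⇒prefix K λ p q p<q q<K →
      right-top p q p<q (<-≤-trans q<K K≤h) (<-trans p<q q<K)

    α γ : ℕ
    α = proj₁ left-prefix
    γ = proj₁ right-prefix

    β≈α : AgreeBelow KK β (_<ᵇ α)
    β≈α = proj₂ (proj₂ left-prefix)

    β≈γ : AgreeBelow K (β ∘ (h +_)) (_<ᵇ γ)
    β≈γ = proj₂ (proj₂ right-prefix)

    γ≤K : γ ≤ K
    γ≤K = proj₁ (proj₂ right-prefix)

    γ≤α : γ ≤ α
    γ≤α = ≮⇒≥ λ α<γ → <-irrefl refl (<ᵇ-true⁻¹ {α} (trans (sym (β≈α α (<-≤-trans (<-≤-trans α<γ γ≤K) (m≤m+n K K))))
      (left≥right α (<-≤-trans α<γ γ≤K) (trans (β≈γ α (<-≤-trans α<γ γ≤K)) (<ᵇ-true α<γ)))))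

  step1-valley : AgreeBelow KK β₁ (valley α (KK ∸ γ))
  step1-valley p p<KK with p <? K
  ... | yes p<K = trans (step1-skips (inj₁ p<K))
                        (trans (β≈α p p<KK) (sym (valley-before α (KK ∸ γ) (<-≤-trans p<K K≤KK∸γ))))
    where
    K≤KK∸γ : K ≤ KK ∸ γ
    K≤KK∸γ = subst (_≤ KK ∸ γ) (m+n∸n≡m K K) (∸-monoʳ-≤ KK γ≤K)
  ... | no  p≮K with m≤n⇒∃[o]m+o≡n (≮⇒≥ p≮K)
  ...   | t , refl = trans (step1-max t<K) (cong₂ _∨_ (β≈α (K + t) p<KK) (trans (β≈γ _ u<K) complement))
    where
    t<K : t < K
    t<K = +-cancelˡ-< K t K p<KK
    u<K : K ∸ suc t < K
    u<K = ∸-monoʳ-< z<s t<K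
    complement : (K ∸ suc t <ᵇ γ) ≡ not (K + t <ᵇ KK ∸ γ)
    complement = trans (<ᵇ-complement t (K ∸ suc t) γ (K ∸ γ) (trans (m+[n∸m]≡n t<K) (sym (m+[n∸m]≡n γ≤K))))
                       (cong not (trans (sym (<ᵇ-+ K)) (cong (K + t <ᵇ_) (sym (+-∸-assoc K γ≤K)))))

  step1-leftHeavy : LeftHeavyValley KK β₁
  step1-leftHeavy with α ≤? KK ∸ γ
  ... | yes α≤KK∸γ = α , KK ∸ γ , (α≤KK∸γ , m∸n≤m KK γ , step1-valley) , KK≤α+[KK∸γ]
    where
    KK≤α+[KK∸γ] : KK ≤ α + (KK ∸ γ)
    KK≤α+[KK∸γ] = ≤-trans (≤-reflexive (sym (m+[n∸m]≡n (≤-trans γ≤K (m≤m+n K K))))) (+-monoˡ-≤ (KK ∸ γ) γ≤α)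
  ... | no  α≰KK∸γ = KK , KK , AllTrue⇒IsValley all1 , m≤m+n KK KK
    where
    all1 : AllTrue KK β₁
    all1 p p<KK = trans (step1-valley p p<KK) (valley-full α _ p (<⇒≤ (≰⇒> α≰KK∸γ)))

  step1-full : KK ≤ α + γ → AllTrue KK β₁
  step1-full KK≤α+γ p p<KK =
    trans (step1-valley p p<KK) (valley-full α (KK ∸ γ) p (m≤n+o⇒m∸n≤o KK γ (subst (KK ≤_) (+-comm α γ) KK≤α+γ)))

  step1-spill : ∀ {q} → KK ≤ q → q < h + h → β₁ q ≡ true → KK ≤ α + γ
  step1-spill {q} KK≤q q<2h β₁q with q <? h
  ... | yes q<h = ≤-trans (AllTrue-prefix⇒≤ {α = α} β≈α ≤-refl left≈1) (m≤m+n α γ)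
    where
    left≈1 : AllTrue KK β
    left≈1 p p<KK = left-top p q (<-≤-trans p<KK KK≤q) q<h p<KK
                              (trans (sym (step1-skips (inj₂ (inj₁ (KK≤q , q<h))))) β₁q)
  ... | no  q≮h with m≤n⇒∃[o]m+o≡n (≮⇒≥ q≮h)
  ...   | s , refl with s <? K
  ...     | yes s<K = begin
    KK                      ≡⟨ cong (K +_) (sym (m+[n∸m]≡n s<K)) ⟩
    K + (suc s + u)         ≡⟨ solve 3 (λ K s u → K :+ ((con 1 :+ s) :+ u) := (con 1 :+ (K :+ u)) :+ s) refl K s u ⟩
    suc (K + u) + s         ≤⟨ +-mono-≤ K+u<α (<⇒≤ s<γ) ⟩
    α + γ                   ∎
    where
    open ≤-Reasoning
    open +-*-Solver
    u : ℕ
    u = K ∸ suc s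
    both : β (K + u) ∧ β (h + s) ≡ true
    both = trans (sym (step1-min s<K)) β₁q
    K+u<α : K + u < α
    K+u<α = <ᵇ-true⁻¹ (trans (sym (β≈α _ (+-monoʳ-< K (∸-monoʳ-< z<s s<K)))) (∧-true⁻¹ˡ both))
    s<γ : s < γ
    s<γ = <ᵇ-true⁻¹ (trans (sym (β≈γ s s<K)) (∧-true⁻¹ʳ both))
  ...     | no  s≮K = +-mono-≤ (AllTrue-prefix⇒≤ {α = α} β≈α (m≤m+n K K) left≈1) (AllTrue-prefix⇒≤ {α = γ} β≈γ ≤-refl right≈1)
    where
    right≈1 : AllTrue K (β ∘ (h +_))
    right≈1 p p<K = right-top p s (<-≤-trans p<K (≮⇒≥ s≮K)) (+-cancelˡ-< h s h q<2h) p<K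
                              (trans (sym (step1-skips (inj₂ (inj₂ (+-monoʳ-≤ h (≮⇒≥ s≮K)))))) β₁q)
    left≈1 : AllTrue K β
    left≈1 p p<K = left≥right p p<K (right≈1 p p<K)

  β₂ : Bits
  β₂ = runᵇ (wires (halfBitMerge c)) β₁

  pwHbitMerge-β₂ : runᵇ (wires (pwHbitMerge d c k≤h)) β ≡ β₂
  pwHbitMerge-β₂ = trans (runᵇ-wires-++ (pwStep1 d c k≤h) _ β) (cong (λ cs → runᵇ cs β₁) (wires-widen (halfBitMerge c)))

  β₂-topOrdered : ∀ p q → p < q → q < h + h → p < KK → β₂ q ≡ true → β₂ p ≡ true
  β₂-topOrdered p q p<q q<2h p<KK β₂q with q <? KK
  ... | yes q<KK = halfBitMerge-sorts c β₁ step1-leftHeavy p q p<q q<KK β₂q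
  ... | no  q≮KK = runᵇ-allTrue (wires (halfBitMerge c)) (wires-below (halfBitMerge c))
                     (step1-full (step1-spill (≮⇒≥ q≮KK) q<2h β₁q)) p p<KK
    where
    β₁q : β₁ q ≡ true
    β₁q = trans (sym (runᵇ-avoid (wires (halfBitMerge c)) β₁
                       (WiresBelow⇒Avoids (wires-below (halfBitMerge c)) (≮⇒≥ q≮KK)))) β₂q

length-layer : ∀ {m n} (C : Fin n → Comparator m) → length (L.map C (allFin n)) ≡ n
length-layer {n = n} C = trans (length-map C (allFin n)) (length-tabulate id)

length-split : ∀ h → length (split h) ≡ h
length-split h = length-layer _

length-halfSplit : ∀ q → length (halfSplit q) ≡ q
length-halfSplit q = length-layer _

length-pwStep1 : ∀ d c (k≤h : pow2 (suc c) ≤ pow2 d) → length (pwStep1 d c k≤h) ≡ pow2 c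
length-pwStep1 d c k≤h = length-layer _

length-∥ : ∀ {m m'} (N : Network m) (N' : Network m') → length (N ∥ N') ≡ length N + length N'
length-∥ N N' = trans (length-++ (L.map _ N)) (cong₂ _+_ (length-map _ N) (length-map _ N'))

private
  doubling : ∀ P a → (P + P) + (suc a * P + suc a * P) ≡ suc (suc a) * (P + P)
  doubling = solve 2 (λ P a → (P :+ P) :+ ((con 1 :+ a) :* P :+ (con 1 :+ a) :* P) := (con 2 :+ a) :* (P :+ P)) refl
    where open +-*-Solver

length-bitMerge : ∀ a → length (bitMerge (suc a)) ≡ suc a * pow2 a
length-bitMerge zero    = refl
length-bitMerge (suc a) = begin
  length (split P′ L.++ (bitMerge (suc a) ∥ bitMerge (suc a)))
    ≡⟨ length-++ (split P′) ⟩
  length (split P′) + length (bitMerge (suc a) ∥ bitMerge (suc a))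
    ≡⟨ cong₂ _+_ (length-split P′) (length-∥ (bitMerge (suc a)) (bitMerge (suc a))) ⟩
  P′ + (length (bitMerge (suc a)) + length (bitMerge (suc a)))
    ≡⟨ cong (λ n → P′ + (n + n)) (length-bitMerge a) ⟩
  P′ + (suc a * pow2 a + suc a * pow2 a)
    ≡⟨ doubling (pow2 a) a ⟩
  suc (suc a) * P′ ∎
  where
  open ≡-Reasoning
  P′ : ℕ
  P′ = pow2 (suc a)

length-halfBitMerge : ∀ c → pow2 c + length (halfBitMerge c) ≡ suc c * pow2 c
length-halfBitMerge zero    = refl
length-halfBitMerge (suc c) = begin
  (q + q) + length (halfSplit q L.++ (halfBitMerge c ∥ bitMerge (suc c)))
    ≡⟨ cong ((q + q) +_) (length-++ (halfSplit q)) ⟩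
  (q + q) + (length (halfSplit q) + length (halfBitMerge c ∥ bitMerge (suc c)))
    ≡⟨ cong ((q + q) +_) (cong₂ _+_ (length-halfSplit q) (length-∥ (halfBitMerge c) (bitMerge (suc c)))) ⟩
  (q + q) + (q + (length (halfBitMerge c) + length (bitMerge (suc c))))
    ≡⟨ cong ((q + q) +_) (+-assoc q _ _) ⟨
  (q + q) + ((q + length (halfBitMerge c)) + length (bitMerge (suc c)))
    ≡⟨ cong ((q + q) +_) (cong₂ _+_ (length-halfBitMerge c) (length-bitMerge c)) ⟩
  (q + q) + (suc c * q + suc c * q)
    ≡⟨ doubling q c ⟩
  suc (suc c) * (q + q) ∎
  where
  open ≡-Reasoning
  q : ℕ
  q = pow2 c

length-pwHbitMerge : ∀ d c (k≤h : pow2 (suc c) ≤ pow2 d) → length (pwHbitMerge d c k≤h) ≡ (pow2 (suc c) * suc c) / 2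
length-pwHbitMerge d c k≤h = begin
  length (pwStep1 d c k≤h L.++ L.map _ (halfBitMerge c))
    ≡⟨ length-++ (pwStep1 d c k≤h) ⟩
  length (pwStep1 d c k≤h) + length (L.map _ (halfBitMerge c))
    ≡⟨ cong₂ _+_ (length-layer _) (length-map _ (halfBitMerge c)) ⟩
  pow2 c + length (halfBitMerge c)
    ≡⟨ length-halfBitMerge c ⟩
  suc c * pow2 c
    ≡⟨ m*n/n≡m (suc c * pow2 c) 2 ⟨
  (suc c * pow2 c * 2) / 2
    ≡⟨ cong (_/ 2) (solve 2 (λ K n → (con 1 :+ n) :* K :* con 2 := (K :+ K) :* (con 1 :+ n)) refl (pow2 c) c) ⟩
  (pow2 (suc c) * suc c) / 2 ∎
  where
  open ≡-Reasoning
  open +-*-Solver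

!-++ˡ : ∀ xs ys {p} → p < length xs → (xs L.++ ys) ! p ≡ xs ! p
!-++ˡ (x ∷ xs) ys {zero}  _        = refl
!-++ˡ (x ∷ xs) ys {suc p} (s≤s p<) = !-++ˡ xs ys p<

!-++ʳ : ∀ xs ys p → (xs L.++ ys) ! (length xs + p) ≡ ys ! p
!-++ʳ []       ys p = refl
!-++ʳ (x ∷ xs) ys p = !-++ʳ xs ys p

module _ {n m} (l : Vec ℕ n) (r : Vec ℕ m) (x : ℕ) where

  threshold-++ˡ : ∀ {p} → p < n → threshold x (l ++ r) p ≡ threshold x l p
  threshold-++ˡ {p} p<n = cong (x ≤ᵇ_)
    (trans (cong (_! p) (toList-++ l r)) (!-++ˡ (toList l) (toList r) (subst (p <_) (sym (length-toList l)) p<n)))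

  threshold-++ʳ : ∀ p → threshold x (l ++ r) (n + p) ≡ threshold x r p
  threshold-++ʳ p = cong (x ≤ᵇ_)
    (trans (cong (λ xs → xs ! (n + p)) (toList-++ l r))
           (trans (cong (λ k → (toList l L.++ toList r) ! (k + p)) (sym (length-toList l)))
                  (!-++ʳ (toList l) (toList r) p)))

threshold-topOrdered : ∀ {n k} (v : Vec ℕ n) x → TopOrdered k (toList v) →
  ∀ p q → p < q → q < n → p < k → threshold x v q ≡ true → threshold x v p ≡ true
threshold-topOrdered v x top p q p<q q<n p<k =
  ≤ᵇ-monoʳ {x} (top p q p<q (subst (q <_) (sym (length-toList v)) q<n) p<k)

pwHbitMerge-topOrdered : ∀ d c (k≤h : pow2 (suc c) ≤ pow2 d) (l r : Vec ℕ (pow2 d)) →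
  TopSorted (pow2 (suc c)) (toList l) → TopSorted (pow2 c) (toList r) →
  ((i : Fin (pow2 d)) → toℕ i < pow2 c → lookup r i ≤ lookup l i) →
  TopOrdered (pow2 (suc c)) (toList (run (pwHbitMerge d c k≤h) (l ++ r)))
pwHbitMerge-topOrdered d c k≤h l r l-top r-top r≤l p q p<q q<len p<k =
  ≤ᵇ-true⁻¹ {x} (trans (output≗β₂ p) (β₂-topOrdered p q p<q q<2h p<k (trans (sym (output≗β₂ q)) (≤ᵇ-true {x} ≤-refl))))
  where
  h : ℕ
  h = pow2 d
  N : Network (h + h)
  N = pwHbitMerge d c k≤h
  x : ℕ
  x = toList (run N (l ++ r)) ! q
  β : Bits
  β = threshold x (l ++ r)
  q<2h : q < h + h
  q<2h = subst (q <_) (length-toList (run N (l ++ r))) q<len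
  left-top : ∀ p q → p < q → q < h → p < pow2 (suc c) → β q ≡ true → β p ≡ true
  left-top p q p<q q<h p<k βq =
    trans (threshold-++ˡ l r x (<-trans p<q q<h))
      (threshold-topOrdered l x (TopSorted⇒TopOrdered _ l-top) p q p<q q<h p<k
        (trans (sym (threshold-++ˡ l r x q<h)) βq))
  right-top : ∀ p q → p < q → q < h → p < pow2 c → β (h + q) ≡ true → β (h + p) ≡ true
  right-top p q p<q q<h p<k′ βq =
    trans (threshold-++ʳ l r x p)
      (threshold-topOrdered r x (TopSorted⇒TopOrdered _ r-top) p q p<q q<h p<k′
        (trans (sym (threshold-++ʳ l r x q)) βq))
  left≥right : ∀ p → p < pow2 c → β (h + p) ≡ true → β p ≡ true
  left≥right p p<k′ βh+p =
    trans (threshold-++ˡ l r x p<h)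
      (≤ᵇ-monoʳ {x} r!p≤l!p (trans (sym (threshold-++ʳ l r x p)) βh+p))
    where
    p<h : p < h
    p<h = <-≤-trans p<k′ (≤-trans (m≤m+n (pow2 c) (pow2 c)) k≤h)
    r!p≤l!p : toList r ! p ≤ toList l ! p
    r!p≤l!p = subst₂ _≤_ (lookup-fromℕ< r p<h) (lookup-fromℕ< l p<h)
                (r≤l (fromℕ< p<h) (subst (_< pow2 c) (sym (toℕ-fromℕ< p<h)) p<k′))
  open PwHbitMergeOnBits d c k≤h β left-top right-top left≥right
  output≗β₂ : threshold x (run N (l ++ r)) ≗ β₂
  output≗β₂ p = trans (threshold-run N (l ++ r) x p) (cong (λ β′ → β′ p) pwHbitMerge-β₂)

theorem3 : (d c : ℕ) (k≤n/2 : pow2 (suc c) ≤ pow2 d)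
    (l r : Vec ℕ (pow2 d)) →
    TopSorted (pow2 (suc c)) (toList l) →
    TopSorted (pow2 c) (toList r) →
    ((i : Fin (pow2 d)) → toℕ i < pow2 c → lookup r i ≤ lookup l i) →
    Sorted (take (pow2 (suc c)) (toList (run (pwHbitMerge d c k≤n/2) (l ++ r))))
    × ((s : List ℕ) → s ↭ toList (l ++ r) → Sorted s →
         take (pow2 (suc c)) (toList (run (pwHbitMerge d c k≤n/2) (l ++ r)))
           ≡ take (pow2 (suc c)) s)
    × length (pwHbitMerge d c k≤n/2) ≡ (pow2 (suc c) * suc c) / 2
theorem3 d c k≤h l r l-top r-top r≤l =
    TopOrdered⇒Sorted-take k output output-top
  , (λ s s↭input s-sorted → ↭-TopOrdered⇒take≡ k (↭-trans (run-↭ N (l ++ r)) (↭-sym s↭input))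
                                                  output-top (Sorted⇒TopOrdered k s-sorted))
  , length-pwHbitMerge d c k≤h
  where
  k : ℕ
  k = pow2 (suc c)
  N : Network (pow2 d + pow2 d)
  N = pwHbitMerge d c k≤h
  output : List ℕ
  output = toList (run N (l ++ r))
  output-top : TopOrdered k output
  output-top = pwHbitMerge-topOrdered d c k≤h l r l-top r-top r≤l
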